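{- Let $L=(X,\le)$ be a finite upper locally distributive lattice generated by a simple Chip Firing Game $CFG(G,\mathcal{O})$ that reaches a fixed point, and identify the elements of $L$ with the configurations of the game via this isomorphism. Let $\mathcal{V}$ be the set of vertices fired in the game, and for each configuration $c$ let $\vartheta(c)$ be the set of vertices fired to obtain $c$ from $\mathcal{O}$. Then: (1) the map $\kappa:M\to\mathcal{V}$ given by $\kappa(m)=\vartheta(c,c')$, where $c,c'$ are any elements with $c\prec c'$ and $\mathfrak{m}(c,c')=m$, is well-defined, and $\kappa$ is a bijection; (2) for every configuration $c$, $\vartheta(c)=\kappa(M\setminus M_c)$.
   Context: Lattice notions: $x\prec y$ means $y$ covers $x$; $M$ is the set of meet-irreducibles (elements with exactly one upper cover), $M_x=\{m\in M:x\le m\}$; $x^{+}$ ($x\ne\mathbf{1}$) is the join of the upper covers of $x$; $L$ is upper locally distributive if each $[x,x^{+}]$ is a Boolean lattice; then for each cover $x\prec y$ the set $M_x\setminus M_y$ has exactly one element $\mathfrak{m}(x,y)$. Chip Firing Games: $G$ a finite directed multigraph with out-degrees $deg^{+}(v)$; a sink is a vertex all of whose outgoing edges are loops. Configurations are maps $V(G)\to\mathbb{N}$; a non-sink $v$ is firable in $c$ if $c(v)\ge deg^{+}(v)$, and firing moves one chip from $v$ along each outgoing edge. $CFG(G,\mathcal{O})$ is the set of configurations reachable from $\mathcal{O}$ ordered by reachability; it reaches a fixed point if there is no infinite firing sequence, and then it is a lattice in which $c\prec c'$ exactly when $c'$ is obtained from $c$ by firing a single vertex, denoted $\vartheta(c,c')$.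 The set of vertices fired (and the number of times each is fired) to reach a given configuration does not depend on the execution. The game is simple if each vertex is fired at most once in any execution. -}

module Defs where

open import Data.Nat using (ℕ; _≤_; _+_; _∸_)
open import Data.Fin using (Fin; _≟_)
open import Data.Vec using (Vec; lookup; tabulate; sum)
open import Data.List using (List; []; _∷_)
open import Data.List.Membership.Propositional using (_∈_)
open import Data.List.Relation.Unary.Unique.Propositional using (Unique)
open import Data.Product using (Σ; ∃; ∃-syntax; _×_; _,_; proj₁)
open import Data.Sum using (_⊎_)
open import Data.Bool using (if_then_else_)
open import Relation.Nullary using (¬_; does)
open import Relation.Binary.PropositionalEquality using (_≡_; _≢_)
open import Induction.WellFounded using (Acc)

-- A finite directed multigraph on the vertex set Fin n is given by its edge
-- multiplicities: E v w = number of edges from v to w (loops allowed).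
Config : ℕ → Set
Config n = Vec ℕ n

module Game {n : ℕ} (E : Fin n → Fin n → ℕ) (O : Config n) where

  deg⁺ : Fin n → ℕ
  deg⁺ v = sum (tabulate (E v))

  IsSink : Fin n → Set
  IsSink v = ∀ w → w ≢ v → E v w ≡ 0

  Firable : Fin n → Config n → Set
  Firable v c = ¬ IsSink v × deg⁺ v ≤ lookup c v

  -- firing v: one chip leaves v along each outgoing edge
  fire : Fin n → Config n → Config n
  fire v c = tabulate λ w →
    if does (w ≟ v)
      then (lookup c v ∸ deg⁺ v) + E v v
      else lookup c w + E v w

  Step : Fin n → Config n → Config n → Set
  Step v c c' = Firable v c × c' ≡ fire v c

  data Exec : Config n → Config n → List (Fin n) → Set where
    done : ∀ {c} → Exec c c []
    step : ∀ {v c c₁ c₂ vs} → Step v c c₁ → Exec c₁ c₂ vs → Exec c c₂ (v ∷ vs)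

  -- reachability (the order of CFG(G,O)): c ≼ c' iff c' is reachable from c
  _≼_ : Config n → Config n → Set
  c ≼ c' = ∃[ vs ] Exec c c' vs

  -- elements of the lattice CFG(G,O): configurations reachable from O
  InL : Config n → Set
  InL c = O ≼ c

  -- the game reaches a fixed point: no infinite firing sequence from O
  -- (well-foundedness of the successor relation at O)
  ReachesFixedPoint : Set
  ReachesFixedPoint = Acc (λ c' c → ∃[ v ] Step v c c') O

  Simple : Set
  Simple = ∀ c vs → Exec O c vs → Unique vs

  _⋖_ : Config n → Config n → Set
  c ⋖ c' = InL c × InL c' × c ≼ c' × c ≢ c'
         × (∀ d → InL d → c ≼ d → d ≼ c' → d ≡ c ⊎ d ≡ c')

  IsMeetIrr : Config n → Set
  IsMeetIrr m = InL m × ∃[ u ] (m ⋖ u × (∀ u' → m ⋖ u' → u' ≡ u))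

  MElem : Set
  MElem = Σ (Config n) IsMeetIrr

  IsTop : Config n → Set
  IsTop x = InL x × (∀ y → InL y → y ≼ x)

  IsLUB : (Config n → Set) → Config n → Set
  IsLUB S p = InL p × (∀ y → S y → y ≼ p)
            × (∀ u → InL u → (∀ y → S y → y ≼ u) → p ≼ u)

  IsJoin : Config n → Config n → Config n → Set
  IsJoin a b j = InL j × a ≼ j × b ≼ j × (∀ u → InL u → a ≼ u → b ≼ u → j ≼ u)

  IsMeet : Config n → Config n → Config n → Set
  IsMeet a b k = InL k × k ≼ a × k ≼ b × (∀ u → InL u → u ≼ a → u ≼ b → u ≼ k)

  InInterval : Config n → Config n → Config n → Set
  InInterval x p y = InL y × x ≼ y × y ≼ p

  -- [x,p] is a Boolean lattice: a distributive, complemented lattice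
  -- with bottom x and top p (meets and joins of elements of [x,p] are taken in L
  -- and stay in [x,p])
  BooleanInterval : Config n → Config n → Set
  BooleanInterval x p =
      (∀ a b c j k₁ k₂ m r →
         InInterval x p a → InInterval x p b → InInterval x p c →
         IsJoin b c j → IsMeet a j m → IsMeet a b k₁ → IsMeet a c k₂ →
         IsJoin k₁ k₂ r → m ≡ r)
    × (∀ a → InInterval x p a →
         ∃[ b ] (InInterval x p b × IsMeet a b x × IsJoin a b p))

  -- upper locally distributive: for every x ≠ 1, [x, x⁺] is Boolean,
  -- where x⁺ is the join of the upper covers of x
  ULD : Set
  ULD = ∀ x xplus → InL x → ¬ IsTop x → IsLUB (λ y → x ⋖ y) xplus
        → BooleanInterval x xplus

  Fired : Config n → Fin n → Set
  Fired c v = ∃[ vs ] (Exec O c vs × v ∈ vs)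

  InV : Fin n → Set
  InV v = ∃[ c ] Fired c v

  -- 𝔪(c,c') = m, i.e. m is the (unique, by ULD) element of M_c ∖ M_c'
  IsMFrak : Config n → Config n → MElem → Set
  IsMFrak c c' m = c ≼ proj₁ m × ¬ (c' ≼ proj₁ m)

module Submission where

-- Firing is strongly confluent (distinct firable vertices stay firable
-- and commute), so two executions from a common configuration can be prolonged
-- to a common one ('confluence').  As every vertex fires at most once, this
-- makes ϑ(c) independent of the execution and turns the order into inclusion
-- of fired sets, c ≼ d ⇔ ϑ(c) ⊆ ϑ(d).  Hence covers are single firings, κ(m)
-- is the only vertex firable at m ∈ M, and m is the greatest configuration in
-- which κ(m) is unfired; this maximality gives the cover labelling,
-- injectivity and part (2).  For surjectivity we fire greedily every vertex
-- but v (terminating by the fixed-point hypothesis) and reach a configuration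
-- where only v is firable, which is meet-irreducible with κ = v.

open import Defs
open import Data.Nat using (ℕ; _+_; _∸_; _≤_; _≤?_) renaming (_≟_ to _≟ℕ_)
open import Data.Nat.Properties using (+-∸-comm; ≤-trans; m≤m+n; +-commutativeSemigroup)
open import Algebra.Properties.CommutativeSemigroup +-commutativeSemigroup using (xy∙z≈xz∙y)
open import Data.Fin using (Fin; _≟_)
open import Data.Fin.Properties using (any?; all?)
open import Data.Vec using (lookup; tabulate)
open import Data.Vec.Properties using (lookup∘tabulate; tabulate∘lookup; tabulate-cong)
open import Data.List using (List; []; _∷_; _++_; [_])
open import Data.List.Membership.Propositional using (_∈_; _∉_)
open import Data.List.Membership.Propositional.Properties using (∈-++⁺ˡ; ∈-++⁺ʳ; ∈-++⁻)
open import Data.List.Relation.Binary.Subset.Propositional using (_⊆_)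
open import Data.List.Relation.Binary.Subset.Propositional.Properties
  using (∷⁺ʳ; ++⁺ʳ)
open import Data.List.Relation.Unary.Any using (here; there)
open import Data.List.Relation.Unary.All as All using ()
open import Data.List.Relation.Unary.AllPairs using (_∷_)
open import Data.List.Relation.Unary.Unique.Propositional using (Unique)
open import Data.Product using (Σ; ∃-syntax; _×_; _,_; proj₁; proj₂)
open import Data.Sum using (_⊎_; inj₁; inj₂)
open import Data.Empty using (⊥; ⊥-elim)
open import Data.Bool using (if_then_else_)
open import Function using (_∘_; case_of_)
open import Function.Bundles using (_⇔_; mk⇔)
open import Induction.WellFounded using (Acc; acc)
open import Relation.Nullary using (¬_; Dec; yes; no)
open import Relation.Nullary.Decidable using (¬?; _×-dec_; _→-dec_; dec-true; dec-false; decidable-stable)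
open import Relation.Binary.PropositionalEquality
  using (_≡_; _≢_; refl; sym; trans; cong; subst; module ≡-Reasoning)

unique-++-disjoint : ∀ {A : Set} {a : A} xs ys → Unique (xs ++ ys) → a ∈ xs → a ∈ ys → ⊥
unique-++-disjoint (x ∷ xs) ys (x∉rest ∷ _) (here refl) a∈ys =
  All.lookup x∉rest (∈-++⁺ʳ xs a∈ys) refl
unique-++-disjoint (x ∷ xs) ys (_ ∷ rest) (there a∈xs) a∈ys =
  unique-++-disjoint xs ys rest a∈xs a∈ys

module ChipFiring {n : ℕ} (E : Fin n → Fin n → ℕ) (O : Config n) where
  open Game E O
  open import Data.List.Membership.DecPropositional (_≟_ {n}) using (_∈?_)

  fire-self : ∀ v c → lookup (fire v c) v ≡ (lookup c v ∸ deg⁺ v) + E v v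
  fire-self v c = trans (lookup∘tabulate _ v)
    (cong (λ b → if b then (lookup c v ∸ deg⁺ v) + E v v else lookup c v + E v v)
          (dec-true (v ≟ v) refl))

  fire-other : ∀ v c x → x ≢ v → lookup (fire v c) x ≡ lookup c x + E v x
  fire-other v c x x≢v = trans (lookup∘tabulate _ x)
    (cong (λ b → if b then (lookup c v ∸ deg⁺ v) + E v v else lookup c x + E v x)
          (dec-false (x ≟ v) x≢v))

  lookup-ext : ∀ {c d : Config n} → (∀ x → lookup c x ≡ lookup d x) → c ≡ d
  lookup-ext {c} {d} same = trans (sym (tabulate∘lookup c))
                                  (trans (tabulate-cong same) (tabulate∘lookup d))

  -- Firing a vertex never removes chips from another vertex, so it keeps
  -- every other vertex firable.
  firable-after : ∀ {u w c} → Firable u c → u ≢ w → Firable u (fire w c)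
  firable-after {u} {w} {c} (non-sink , loaded) u≢w =
    non-sink , subst (deg⁺ u ≤_) (sym (fire-other w c u u≢w)) (≤-trans loaded (m≤m+n _ _))

  commute-at-second : ∀ {u w c} → Firable w c → w ≢ u →
                      lookup (fire w (fire u c)) w ≡ lookup (fire u (fire w c)) w
  commute-at-second {u} {w} {c} (_ , w-loaded) w≢u = begin
    lookup (fire w (fire u c)) w
      ≡⟨ fire-self w (fire u c) ⟩
    (lookup (fire u c) w ∸ deg⁺ w) + E w w
      ≡⟨ cong (λ k → (k ∸ deg⁺ w) + E w w) (fire-other u c w w≢u) ⟩
    (lookup c w + E u w ∸ deg⁺ w) + E w w
      ≡⟨ cong (_+ E w w) (+-∸-comm (E u w) w-loaded) ⟩
    (lookup c w ∸ deg⁺ w) + E u w + E w w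
      ≡⟨ xy∙z≈xz∙y _ (E u w) (E w w) ⟩
    (lookup c w ∸ deg⁺ w) + E w w + E u w
      ≡⟨ cong (_+ E u w) (fire-self w c) ⟨
    lookup (fire w c) w + E u w
      ≡⟨ fire-other u (fire w c) w w≢u ⟨
    lookup (fire u (fire w c)) w
      ∎
    where open ≡-Reasoning

  fire-commute : ∀ {u w c} → Firable u c → Firable w c → u ≢ w →
                 fire w (fire u c) ≡ fire u (fire w c)
  fire-commute {u} {w} {c} Fu Fw u≢w = lookup-ext chips
    where
    open ≡-Reasoning
    chips : ∀ x → lookup (fire w (fire u c)) x ≡ lookup (fire u (fire w c)) x
    chips x with x ≟ w | x ≟ u
    ... | yes refl | _        = commute-at-second {u} {w} {c} Fw (u≢w ∘ sym)
    ... | no _     | yes refl = sym (commute-at-second {w} {u} {c} Fu u≢w)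
    ... | no x≢w   | no x≢u   = begin
      lookup (fire w (fire u c)) x  ≡⟨ fire-other w (fire u c) x x≢w ⟩
      lookup (fire u c) x + E w x   ≡⟨ cong (_+ E w x) (fire-other u c x x≢u) ⟩
      lookup c x + E u x + E w x    ≡⟨ xy∙z≈xz∙y (lookup c x) (E u x) (E w x) ⟩
      lookup c x + E w x + E u x    ≡⟨ cong (_+ E u x) (fire-other w c x x≢w) ⟨
      lookup (fire w c) x + E u x   ≡⟨ fire-other u (fire w c) x x≢u ⟨
      lookup (fire u (fire w c)) x  ∎

  firable? : ∀ w c → Dec (Firable w c)
  firable? w c =
    ¬? (all? (λ x → ¬? (x ≟ w) →-dec (E w x ≟ℕ 0))) ×-dec (deg⁺ w ≤? lookup c w)

  exec-++ : ∀ {a b c s t} → Exec a b s → Exec b c t → Exec a c (s ++ t)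
  exec-++ done e = e
  exec-++ (step st e₁) e₂ = step st (exec-++ e₁ e₂)

  extend : ∀ {a c c' s w} → Exec a c s → Step w c c' → Exec a c' (s ++ [ w ])
  extend e st = exec-++ e (step st done)

  fired-monotone : ∀ {c d v} → c ≼ d → Fired c v → Fired d v
  fired-monotone (r , ecd) (s , ec , v∈s) = s ++ r , exec-++ ec ecd , ∈-++⁺ˡ v∈s

  firable-along : ∀ {c d vs w} → Exec c d vs → Firable w c → w ∉ vs → Firable w d
  firable-along done Fw _ = Fw
  firable-along {w = w} (step {v = u} {c = c} (_ , refl) e) Fw w∉ =
    firable-along e (firable-after {w} {u} {c} Fw (w∉ ∘ here)) (w∉ ∘ there)

  shift-by : ∀ {c d vs w} → Exec c d vs → Firable w c → w ∉ vs → Exec (fire w c) (fire w d) vs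
  shift-by done _ _ = done
  shift-by {w = w} (step {v = u} {c = c} (Fu , refl) e) Fw w∉ =
    step (firable-after {u} {w} {c} Fu u≢w , fire-commute {u} {w} {c} Fu Fw u≢w)
         (shift-by e (firable-after {w} {u} {c} Fw (u≢w ∘ sym)) (w∉ ∘ there))
    where
    u≢w : u ≢ w
    u≢w = w∉ ∘ here ∘ sym

  residual : ∀ {x y t a} → Exec x y t → Firable a x → a ∈ t →
             ∃[ t₀ ] (Exec (fire a x) y t₀ × t₀ ⊆ t)
  residual {x = x} {a = a} (step {v = v} (Fv , refl) e) Fa a∈t with a ≟ v | a∈t
  ... | yes refl | _ = _ , e , there
  ... | no a≢v | here a≡v = ⊥-elim (a≢v a≡v)
  ... | no a≢v | there a∈vs with residual e (firable-after {a} {v} {x} Fa a≢v) a∈vs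
  ...   | t₀ , e₀ , t₀⊆vs =
    v ∷ t₀ ,
    step (firable-after {v} {a} {x} Fv (a≢v ∘ sym) , refl)
         (subst (λ z → Exec z _ t₀) (fire-commute {v} {a} {x} Fv Fa (a≢v ∘ sym)) e₀) ,
    ∷⁺ʳ v t₀⊆vs

  record Confluent (y z : Config n) (t u : List (Fin n)) : Set where
    field
      apex     : Config n
      t′ u′    : List (Fin n)
      left     : Exec y apex t′
      right    : Exec z apex u′
      complete : ∀ {a} → a ∈ u → a ∉ t → a ∈ t′
      within   : t′ ⊆ u
  open Confluent

  confluence : ∀ {x y z t u} → Exec x y t → Exec x z u → Confluent y z t u
  confluence {y = y} {t = t} ey done = record
    { apex = y ; t′ = [] ; u′ = t ; left = done ; right = ey
    ; complete = λ () ; within = λ () }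
  confluence {t = t} ey (step {v = a} (Fa , refl) ez) with a ∈? t
  ... | no a∉t = record
    { apex = apex J ; t′ = a ∷ t′ J ; u′ = u′ J
    ; left = step (firable-along ey Fa a∉t , refl) (left J)
    ; right = right J
    ; complete = λ { (here refl) _ → here refl ; (there b∈u) b∉t → there (complete J b∈u b∉t) }
    ; within = ∷⁺ʳ a (within J) }
    where J = confluence (shift-by ey Fa a∉t) ez
  ... | yes a∈t with residual ey Fa a∈t
  ...   | t₀ , ey₀ , t₀⊆t = record
    { apex = apex J ; t′ = t′ J ; u′ = u′ J ; left = left J ; right = right J
    ; complete = λ { (here refl) a∉t → ⊥-elim (a∉t a∈t)
                   ; (there b∈u) b∉t → complete J b∈u (b∉t ∘ t₀⊆t) }
    ; within = there ∘ within J }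
    where J = confluence ey₀ ez

  module SimpleGame (simple : Simple) where

    fires-once : ∀ {c d s t a} → Exec O c s → Exec c d t → a ∈ s → a ∈ t → ⊥
    fires-once {s = s} {t} es et = unique-++-disjoint s t (simple _ _ (exec-++ es et))

    -- Any two executions from O to c fire the same vertices, so ϑ(c) is well
    -- defined: a vertex missing from s₁ could be fired again after s₂.
    fired-determined : ∀ {c s₁ s₂} → Exec O c s₁ → Exec O c s₂ → s₂ ⊆ s₁
    fired-determined {s₁ = s₁} e₁ e₂ {a} a∈s₂ with a ∈? s₁
    ... | yes a∈s₁ = a∈s₁
    ... | no a∉s₁ = ⊥-elim (fires-once e₂ (left J) a∈s₂ (complete J a∈s₂ a∉s₁))
      where J = confluence e₁ e₂

    fired⇒∈ : ∀ {c s v} → Exec O c s → Fired c v → v ∈ s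
    fired⇒∈ e (_ , e′ , v∈) = fired-determined e e′ v∈

    ≼⇒⊆ : ∀ {c d s t} → Exec O c s → Exec O d t → c ≼ d → s ⊆ t
    ≼⇒⊆ ec ed (_ , e) = fired-determined ed (exec-++ ec e) ∘ ∈-++⁺ˡ

    ⊆⇒≼ : ∀ {c d s t} → Exec O c s → Exec O d t → s ⊆ t → c ≼ d
    ⊆⇒≼ {s = s} {t} ec ed s⊆t with confluence ec ed
    ... | record { t′ = t′ ; left = ec′ ; right = done } = t′ , ec′
    ... | record { left = ec′ ; right = step {v = a} st ed′ ; within = t′⊆t } =
      ⊥-elim (fires-once ed (step st ed′) a∈t (here refl))
      where
      -- a is fired on the way from O to the apex, whose fired set is s ++ t′ ⊆ t
      a∈t : a ∈ t
      a∈t with ∈-++⁻ s (fired-determined (exec-++ ec ec′) (exec-++ ed (step st ed′))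
                                          (∈-++⁺ʳ t (here refl)))
      ... | inj₁ a∈s = s⊆t a∈s
      ... | inj₂ a∈t′ = t′⊆t a∈t′

    no-cycle : ∀ {x a r} → InL x → Exec x x (a ∷ r) → ⊥
    no-cycle {a = a} (s , es) cyc =
      fires-once es cyc (fired-determined es (exec-++ es cyc) (∈-++⁺ʳ s (here refl))) (here refl)

    ≼-antisym : ∀ {x y} → InL x → x ≼ y → y ≼ x → x ≡ y
    ≼-antisym _ ([] , done) _ = refl
    ≼-antisym Lx (a ∷ r₁ , e₁) (r₂ , e₂) = ⊥-elim (no-cycle Lx (exec-++ e₁ e₂))

    step⇒cover : ∀ {c c' w} → InL c → Step w c c' → c ⋖ c'
    step⇒cover {c} {c'} {w} (s , es) st =
      (s , es) , (s ++ [ w ] , es′) , ([ w ] , step st done) ,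
      (λ { refl → no-cycle (s , es) (step st done) }) , between
      where
      es′ : Exec O c' (s ++ [ w ])
      es′ = extend es st
      -- ϑ(c) ⊆ ϑ(d) ⊆ ϑ(c) ∪ {w}, so d is c or c' according to whether w ∈ ϑ(d)
      between : ∀ d → InL d → c ≼ d → d ≼ c' → d ≡ c ⊎ d ≡ c'
      between d (t , ed) c≼d d≼c' with w ∈? t
      ... | yes w∈t = inj₂ (≼-antisym (t , ed) d≼c'
            (⊆⇒≼ es′ ed (λ a∈ → case ∈-++⁻ s a∈ of λ
              { (inj₁ a∈s) → ≼⇒⊆ es ed c≼d a∈s ; (inj₂ (here refl)) → w∈t })))
      ... | no w∉t = inj₁ (≼-antisym (t , ed)
            (⊆⇒≼ ed es (λ a∈t → case ∈-++⁻ s (≼⇒⊆ ed es′ d≼c' a∈t) of λ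
              { (inj₁ a∈s) → a∈s ; (inj₂ (here refl)) → ⊥-elim (w∉t a∈t) }))
            c≼d)

    cover⇒step : ∀ {c c'} → c ⋖ c' → ∃[ w ] Step w c c'
    cover⇒step (_ , _ , ([] , done) , c≢c' , _) = ⊥-elim (c≢c' refl)
    cover⇒step (Lc@(s , es) , _ , (w ∷ r , step {c₁ = c₁} st e) , _ , between)
      with between c₁ (_ , extend es st) ([ w ] , step st done) (r , e)
    ... | inj₁ refl = ⊥-elim (no-cycle Lc (step st done))
    ... | inj₂ refl = w , st

    step-vertex-unique : ∀ {m u a b} → InL m → Step a m u → Step b m u → a ≡ b
    step-vertex-unique {a = a} {b} (s , es) sa sb
      with ∈-++⁻ s (fired-determined (extend es sa) (extend es sb) (∈-++⁺ʳ s (here refl)))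
    ... | inj₁ b∈s = ⊥-elim (fires-once es (step sb done) b∈s (here refl))
    ... | inj₂ (here b≡a) = sym b≡a

    step-vertex-unfired : ∀ {m u a} → InL m → Step a m u → ¬ Fired m a
    step-vertex-unfired (s , es) sa fired =
      fires-once es (step sa done) (fired⇒∈ es fired) (here refl)

    κ : MElem → Fin n
    κ (_ , _ , _ , m⋖u , _) = proj₁ (cover⇒step m⋖u)

    upper : MElem → Config n
    upper (_ , _ , u , _) = u

    κ-step : (M : MElem) → Step (κ M) (proj₁ M) (upper M)
    κ-step (_ , _ , _ , m⋖u , _) = proj₂ (cover⇒step m⋖u)

    inL : (M : MElem) → InL (proj₁ M)
    inL (_ , Lm , _) = Lm

    -- κ(m) is the only vertex firable at m, since each firing gives a cover.
    κ-only-firable : (M : MElem) {w : Fin n} → Firable w (proj₁ M) → w ≡ κ M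
    κ-only-firable M@(m , Lm , _ , _ , unique-cover) {w} Fw =
      step-vertex-unique Lm (subst (Step w m) fire-w-is-upper (Fw , refl)) (κ-step M)
      where
      fire-w-is-upper : fire w m ≡ upper M
      fire-w-is-upper = unique-cover _ (step⇒cover Lm (Fw , refl))

    κ-unfired : (M : MElem) → ¬ Fired (proj₁ M) (κ M)
    κ-unfired M = step-vertex-unfired (inL M) (κ-step M)

    unfired⇒≼ : (M : MElem) (c : Config n) → InL c → ¬ Fired c (κ M) → c ≼ proj₁ M
    unfired⇒≼ M c (sc , ec) unfired with confluence (proj₂ (inL M)) ec
    ... | record { u′ = u′ ; left = done ; right = ec′ } = u′ , ec′
    ... | record { left = step {v = a} (Fa , refl) _ ; within = t′⊆sc } =
      ⊥-elim (unfired (subst (Fired c) (κ-only-firable M Fa) (sc , ec , t′⊆sc (here refl))))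

    OnlyFirable : Fin n → Config n → Set
    OnlyFirable v m = ∀ w → Firable w m → w ≡ v

    meet-irreducible-at : ∀ {m v} → InL m → Firable v m → OnlyFirable v m →
                          Σ (IsMeetIrr m) λ irr → κ (m , irr) ≡ v
    meet-irreducible-at {m} {v} Lm Fv only =
      irr , sym (step-vertex-unique Lm (Fv , refl) (κ-step (m , irr)))
      where
      unique-cover : ∀ u′ → m ⋖ u′ → u′ ≡ fire v m
      unique-cover u′ m⋖u′ with cover⇒step m⋖u′
      ... | w , (Fw , refl) with only w Fw
      ...   | refl = refl
      irr : IsMeetIrr m
      irr = Lm , fire v m , step⇒cover Lm (Fv , refl) , unique-cover

    Successor : Config n → Config n → Set
    Successor c' c = ∃[ v ] Step v c c'

    saturate-avoiding : ∀ v c → InL c → Acc Successor c → ¬ Fired c v →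
                        ∃[ m ] (InL m × ¬ Fired m v × OnlyFirable v m)
    saturate-avoiding v c Lc@(s , es) (acc next) unfired
      with any? (λ w → ¬? (w ≟ v) ×-dec firable? w c)
    ... | no stuck =
      c , Lc , unfired , λ w Fw → decidable-stable (w ≟ v) (λ w≢v → stuck (w , w≢v , Fw))
    ... | yes (w , w≢v , Fw) =
      saturate-avoiding v (fire w c) (_ , extend es (Fw , refl)) (next (w , Fw , refl)) still-unfired
      where
      still-unfired : ¬ Fired (fire w c) v
      still-unfired fired with ∈-++⁻ s (fired⇒∈ (extend es (Fw , refl)) fired)
      ... | inj₁ v∈s = unfired (s , es , v∈s)
      ... | inj₂ (here v≡w) = w≢v (sym v≡w)

    -- Surjectivity: the saturated configuration must still be able to fire v,
    -- because v is fired on the way to some configuration.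
    κ-surjective : ReachesFixedPoint → ∀ v → InV v → ∃[ M ] (κ M ≡ v)
    κ-surjective fixed-point v (c₀ , s₀ , e₀ , v∈s₀)
      with saturate-avoiding v O ([] , done) fixed-point (λ fired → case fired⇒∈ done fired of λ ())
    ... | m , Lm@(sm , em) , unfired , only with confluence em e₀
    ...   | record { left = done ; complete = complete′ } =
      case complete′ v∈s₀ (λ v∈sm → unfired (sm , em , v∈sm)) of λ ()
    ...   | record { left = step {v = a} (Fa , refl) _ } with only a Fa
    ...     | refl = let (irr , κ≡v) = meet-irreducible-at Lm Fa only in (m , irr) , κ≡v

    -- The cover
    -- fires some w; were w fired between c and m we would get ϑ(c') ⊆ ϑ(m), i.e.
    -- c' ≼ m, so w is still firable at m, where only κ(m) is firable.
    κ-labels-covers : ∀ c c' (M : MElem) → c ⋖ c' → IsMFrak c c' M → Step (κ M) c c'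
    κ-labels-covers c c' M c⋖c' ((r , ecm) , c'⋠m) with cover⇒step c⋖c' | proj₁ c⋖c'
    ... | w , st | sc , ec with w ∈? r
    ... | yes w∈r =
      ⊥-elim (c'⋠m (⊆⇒≼ (extend ec st) (exec-++ ec ecm) (++⁺ʳ sc (λ { (here refl) → w∈r }))))
    ... | no w∉r =
      subst (λ x → Step x c c') (κ-only-firable M (firable-along ecm (proj₁ st) w∉r)) st

    κ-fired : (M : MElem) → InV (κ M)
    κ-fired M = upper M , proj₁ (inL M) ++ [ κ M ] , extend (proj₂ (inL M)) (κ-step M) ,
                ∈-++⁺ʳ (proj₁ (inL M)) (here refl)

    -- Injectivity: m₁ and m₂ are both the greatest configuration not firing κ.
    κ-injective : (M₁ M₂ : MElem) → κ M₁ ≡ κ M₂ → proj₁ M₁ ≡ proj₁ M₂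
    κ-injective M₁ M₂ same = ≼-antisym (inL M₁)
      (unfired⇒≼ M₂ _ (inL M₁) (subst (¬_ ∘ Fired (proj₁ M₁)) same (κ-unfired M₁)))
      (unfired⇒≼ M₁ _ (inL M₂) (subst (¬_ ∘ Fired (proj₁ M₂)) (sym same) (κ-unfired M₂)))

    fired-set : ReachesFixedPoint → ∀ c → InL c → ∀ v →
                Fired c v ⇔ (∃[ M ] (¬ (c ≼ proj₁ M) × κ M ≡ v))
    fired-set fixed-point c (sc , ec) v = mk⇔ to from
      where
      to : Fired c v → ∃[ M ] (¬ (c ≼ proj₁ M) × κ M ≡ v)
      to fired with κ-surjective fixed-point v (c , fired)
      ... | M , refl = M , (λ c≼m → κ-unfired M (fired-monotone c≼m fired)) , refl
      from : ∃[ M ] (¬ (c ≼ proj₁ M) × κ M ≡ v) → Fired c v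
      from (M , c⋠m , refl) with κ M ∈? sc
      ... | yes v∈sc = sc , ec , v∈sc
      ... | no v∉sc = ⊥-elim (c⋠m (unfired⇒≼ M c (sc , ec) (v∉sc ∘ fired⇒∈ ec)))

mainTheorem9 : {n : ℕ} (E : Fin n → Fin n → ℕ) (O : Config n) →
  let open Game E O in
  ReachesFixedPoint → Simple → ULD →
  Σ (MElem → Fin n) λ κ →
    (∀ c c' (m : MElem) → c ⋖ c' → IsMFrak c c' m → Step (κ m) c c')
    × (∀ m → InV (κ m))
    × (∀ m₁ m₂ → κ m₁ ≡ κ m₂ → proj₁ m₁ ≡ proj₁ m₂)
    × (∀ v → InV v → ∃[ m ] (κ m ≡ v))
    × (∀ c → InL c → ∀ v → (Fired c v ⇔ (∃[ m ] (¬ (c ≼ proj₁ m) × κ m ≡ v))))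
mainTheorem9 E O fixed-point simple _ =
  κ , κ-labels-covers , κ-fired , κ-injective , κ-surjective fixed-point , fired-set fixed-point
  where open ChipFiring.SimpleGame E O simple
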